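{- For all $n,m\ge1$, $R(n,m)\subseteq R(n,m+1)$.
   Context: A complementary alphabet with $m$ complementary pairs is a set of $2m$ letters in which every letter $B$ has a unique complement $\overline{B}\neq B$ with $\overline{\overline{B}}=B$. A plane tree is a rooted tree with linearly ordered children at each vertex. For a plane tree with $n$ edges, the $2n$ half-edges are labeled $1,\dots,2n$ by starting on the left side of the leftmost root edge and walking counterclockwise; each edge is $e(i,j)$, $i<j$, with $i,j$ the labels of its sides. For $P=p_1\cdots p_{2n}$, a plane tree with $n$ edges is $P$-valid if $p_i,p_j$ are complements for every edge $e(i,j)$. $R(n,m)$ is the set of integers $k$ such that some word $P$ of length $2n$ over a complementary alphabet with $m$ pairs has exactly $k\ge1$ $P$-valid plane trees. -}

module Defs where

open import Data.Nat using (ℕ; zero; suc; _*_; _≤_)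
open import Data.Fin using (Fin) renaming (_≟_ to _≟ᶠ_)
open import Data.Bool using (Bool; true; false; not; _∧_)
open import Data.Bool.Properties using () renaming (_≟_ to _≟ᵇ_)
open import Data.List using (List; []; _∷_; _++_; length)
open import Data.Vec using (Vec; []; _∷_)
open import Data.Maybe using (Maybe; just; nothing)
open import Data.Product using (Σ; _×_; _,_; proj₁)
open import Relation.Nullary.Decidable using (⌊_⌋)
open import Relation.Binary.PropositionalEquality using (_≡_)
open import Function.Bundles using (_↔_)

data PlaneTree : Set where
  node : List PlaneTree → PlaneTree

-- Contour walk of a forest (ordered list of subtrees hanging from a vertex),
-- starting at half-edge label s (labels are 0-based: label i here is i+1 in the paper).
-- Returns the edges e(i,j) (i = side met when descending, j = side met when ascending)
-- and the next unused label.
forestEdges : ℕ → List PlaneTree → List (ℕ × ℕ) × ℕ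
forestEdges s [] = [] , s
forestEdges s (node cs ∷ ts) with forestEdges (suc s) cs
... | es₁ , s₁ with forestEdges (suc s₁) ts
... | es₂ , s₂ = ((s , s₁) ∷ es₁) ++ es₂ , s₂

edges : PlaneTree → List (ℕ × ℕ)
edges (node cs) = proj₁ (forestEdges 0 cs)

numEdges : PlaneTree → ℕ
numEdges t = length (edges t)

-- A complementary alphabet with m pairs: letters (a , b), complement flips b.
Letter : ℕ → Set
Letter m = Fin m × Bool

complement : ∀ {m} → Letter m → Letter m
complement (a , b) = a , not b

areComplements : ∀ {m} → Letter m → Letter m → Bool
areComplements (a , b) (a′ , b′) = ⌊ a ≟ᶠ a′ ⌋ ∧ ⌊ b ≟ᵇ not b′ ⌋

lookupℕ : ∀ {A : Set} {k} → Vec A k → ℕ → Maybe A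
lookupℕ [] _ = nothing
lookupℕ (x ∷ xs) zero = just x
lookupℕ (x ∷ xs) (suc i) = lookupℕ xs i

edgeOK : ∀ {m k} → Vec (Letter m) k → ℕ × ℕ → Bool
edgeOK P (i , j) with lookupℕ P i | lookupℕ P j
... | just x | just y = areComplements x y
... | _ | _ = false

allEdgesOK : ∀ {m k} → Vec (Letter m) k → List (ℕ × ℕ) → Bool
allEdgesOK P [] = true
allEdgesOK P (e ∷ es) = edgeOK P e ∧ allEdgesOK P es

isValid : ∀ {m k} → Vec (Letter m) k → PlaneTree → Bool
isValid P t = allEdgesOK P (edges t)

ValidTrees : ∀ {m} (n : ℕ) → Vec (Letter m) (2 * n) → Set
ValidTrees n P = Σ PlaneTree λ t → numEdges t ≡ n × isValid P t ≡ true

-- k ∈ R(n,m): k ≥ 1 and some word P of length 2n over the alphabet with m pairs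
-- has exactly k P-valid plane trees (a bijection Fin k ↔ set of such trees).
InR : ℕ → ℕ → ℕ → Set
InR n m k = 1 ≤ k × Σ (Vec (Letter m) (2 * n)) λ P → Fin k ↔ ValidTrees n P

-- Embedding the alphabet with m pairs into the one with m + 1 pairs preserves and reflects
-- complementarity, so it does not change which plane trees are valid for a word; the image
-- of a word with exactly k valid trees therefore again has exactly k valid trees.
module Submission where

open import Defs
open import Data.Nat using (ℕ; zero; suc; _*_; _≤_)
open import Data.Fin using (Fin; inject₁) renaming (_≟_ to _≟ᶠ_)
open import Data.Fin.Properties using (inject₁-injective)
open import Data.Bool using (not; _∧_)
import Data.Bool.Properties as Bool
open import Axiom.UniquenessOfIdentityProofs using (module Decidable⇒UIP)
open import Data.Vec using (Vec; []; _∷_; map)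
import Data.Maybe as Maybe
open import Data.Maybe using (just; nothing)
open import Data.List using ([]; _∷_)
open import Data.Product using (_,_)
open import Relation.Nullary using (yes; no; contradiction)
open import Relation.Nullary.Decidable using (⌊_⌋)
open import Relation.Binary.PropositionalEquality using (_≡_; refl; sym; trans; cong; cong₂)
open import Function.Bundles using (_↔_; mk↔ₛ′)
open import Function.Properties.Inverse using (↔-trans)

PreservesComplements : ∀ {m m′} → (Letter m → Letter m′) → Set
PreservesComplements f = ∀ x y → areComplements (f x) (f y) ≡ areComplements x y

lookupℕ-map : ∀ {A B : Set} {k} (f : A → B) (P : Vec A k) i →
              lookupℕ (map f P) i ≡ Maybe.map f (lookupℕ P i)
lookupℕ-map f []      i       = refl
lookupℕ-map f (x ∷ P) zero    = refl
lookupℕ-map f (x ∷ P) (suc i) = lookupℕ-map f P i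

module _ {m m′} {f : Letter m → Letter m′} (f-compl : PreservesComplements f) where

  edgeOK-map : ∀ {k} (P : Vec (Letter m) k) e → edgeOK (map f P) e ≡ edgeOK P e
  edgeOK-map P (i , j) rewrite lookupℕ-map f P i | lookupℕ-map f P j
    with lookupℕ P i | lookupℕ P j
  ... | just x  | just y  = f-compl x y
  ... | just _  | nothing = refl
  ... | nothing | just _  = refl
  ... | nothing | nothing = refl

  allEdgesOK-map : ∀ {k} (P : Vec (Letter m) k) es → allEdgesOK (map f P) es ≡ allEdgesOK P es
  allEdgesOK-map P []       = refl
  allEdgesOK-map P (e ∷ es) = cong₂ _∧_ (edgeOK-map P e) (allEdgesOK-map P es)

  isValid-map : ∀ {k} (P : Vec (Letter m) k) t → isValid (map f P) t ≡ isValid P t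
  isValid-map P t = allEdgesOK-map P (edges t)

ValidTrees-cong : ∀ {m m′} n (P : Vec (Letter m) (2 * n)) (Q : Vec (Letter m′) (2 * n)) →
                  (∀ t → isValid P t ≡ isValid Q t) → ValidTrees n P ↔ ValidTrees n Q
ValidTrees-cong n P Q same = mk↔ₛ′ to from to∘from from∘to
  where
  open Decidable⇒UIP Bool._≟_ using (≡-irrelevant)
  to : ValidTrees n P → ValidTrees n Q
  to (t , size , valid) = t , size , trans (sym (same t)) valid
  from : ValidTrees n Q → ValidTrees n P
  from (t , size , valid) = t , size , trans (same t) valid
  to∘from : ∀ v → to (from v) ≡ v
  to∘from (t , size , valid) = cong (λ valid′ → t , size , valid′) (≡-irrelevant _ _)
  from∘to : ∀ v → from (to v) ≡ v
  from∘to (t , size , valid) = cong (λ valid′ → t , size , valid′) (≡-irrelevant _ _)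

InR-map : ∀ {n m m′ k} (f : Letter m → Letter m′) → PreservesComplements f → InR n m k → InR n m′ k
InR-map {n} f f-compl (k≥1 , P , count) =
  k≥1 , map f P , ↔-trans count (ValidTrees-cong n P (map f P) (λ t → sym (isValid-map f-compl P t)))

⌊inject₁≟inject₁⌋ : ∀ {m} (a a′ : Fin m) → ⌊ inject₁ a ≟ᶠ inject₁ a′ ⌋ ≡ ⌊ a ≟ᶠ a′ ⌋
⌊inject₁≟inject₁⌋ a a′ with a ≟ᶠ a′ | inject₁ a ≟ᶠ inject₁ a′
... | yes _    | yes _    = refl
... | no _     | no _     = refl
... | yes a≡a′ | no ia≢ia′ = contradiction (cong inject₁ a≡a′) ia≢ia′
... | no a≢a′  | yes ia≡ia′ = contradiction (inject₁-injective ia≡ia′) a≢a′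

injectLetter : ∀ {m} → Letter m → Letter (suc m)
injectLetter (a , b) = inject₁ a , b

injectLetter-preservesComplements : ∀ {m} → PreservesComplements (injectLetter {m})
injectLetter-preservesComplements (a , b) (a′ , b′) =
  cong (_∧ ⌊ b Bool.≟ not b′ ⌋) (⌊inject₁≟inject₁⌋ a a′)

mainTheorem12 : (n m : ℕ) → 1 ≤ n → 1 ≤ m → (k : ℕ) → InR n m k → InR n (suc m) k
mainTheorem12 n m _ _ k = InR-map injectLetter injectLetter-preservesComplements
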